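{- Let $X$ be an indeterminate and work in $\mathbb{Q}(X)$. For integers $j\ge 0$ put \[ a_j=\sum_h\binom{j+1+h}{2h+1}X^h,\qquad b_j=\sum_h\binom{j+1+h}{2h}X^h,\qquad c_j=\sum_h\binom{j+2+h}{2h+1}X^h. \] For a positive integer $n$ let $M$ be the $n\times n$ matrix with entries \[ M_{i,j}=\binom{i}{j}X+\binom{i+2}{j+1},\qquad 0\le i,j<n. \] Define $n\times n$ matrices $L$ and $U$ (indices $0,\dots,n-1$) by \[ L_{i,j}=\frac{\binom{i+1}{j+1}a_j+\binom{i}{j}b_j}{c_j}, \] \[ U_{j,j}=\frac{c_j}{a_j},\qquad U_{j,j+1}=1,\qquad U_{j,l}=0\ \text{ for } l\ge j+2 \text{ or } l<j. \] Then $L$ is lower unitriangular and $M=LU$.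
   Context: Sums over $h$ run over all integers $h$ with finitely many nonzero terms; binomial coefficients $\binom ab$ with $a,b$ nonnegative integers are the usual ones, zero when $b>a$ or $b<0$. -}

module Defs where

open import Data.Nat as ℕ using (ℕ; zero; suc; _≟_)
open import Data.Nat.Combinatorics using (_C_; nC1≡n)
open import Data.Integer as ℤ using (ℤ; +_)
open import Data.List using (List; []; _∷_; map; applyUpTo)
open import Data.Fin using (Fin; toℕ)
import Data.Nat.Properties
open import Data.Product using (_×_)
open import Data.Empty using (⊥)
open import Relation.Nullary using (¬_; yes; no)
open import Relation.Binary.PropositionalEquality using (_≡_; refl; cong)
open import Data.Nat.Properties using (+-identityʳ)

-- ℤ[X]: polynomials as coefficient lists (lowest degree first);
-- equality is equality of all coefficients (trailing zeros irrelevant).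

Poly : Set
Poly = List ℤ

coeff : Poly → ℕ → ℤ
coeff []      _       = + 0
coeff (x ∷ p) zero    = x
coeff (x ∷ p) (suc n) = coeff p n

infix 4 _≈P_
_≈P_ : Poly → Poly → Set
p ≈P q = ∀ n → coeff p n ≡ coeff q n

infixl 6 _+P_
_+P_ : Poly → Poly → Poly
[]      +P q       = q
(x ∷ p) +P []      = x ∷ p
(x ∷ p) +P (y ∷ q) = (x ℤ.+ y) ∷ (p +P q)

scaleP : ℤ → Poly → Poly
scaleP a p = map (a ℤ.*_) p

infixl 7 _*P_
_*P_ : Poly → Poly → Poly
[]      *P q = []
(a ∷ p) *P q = scaleP a q +P (+ 0 ∷ (p *P q))

constP : ℤ → Poly
constP c = c ∷ []

Xp : Poly
Xp = + 0 ∷ + 1 ∷ []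

-- ℚ(X) = Frac(ℤ[X]): formal fractions num/den, with the usual
-- cross-multiplication equality.  All denominators occurring in the
-- theorem are products of 1, a_j, c_j, which are nonzero (see aNZ, cNZ).

infix 7 _/_
record QX : Set where
  constructor _/_
  field
    num : Poly
    den : Poly
open QX public

infix 4 _≈_
_≈_ : QX → QX → Set
f ≈ g = num f *P den g ≈P num g *P den f

infixl 6 _+Q_
_+Q_ : QX → QX → QX
(p / q) +Q (r / s) = (p *P s +P r *P q) / (q *P s)

infixl 7 _*Q_
_*Q_ : QX → QX → QX
(p / q) *Q (r / s) = (p *P r) / (q *P s)

embed : Poly → QX
embed p = p / constP (+ 1)

0Q 1Q : QX
0Q = embed []
1Q = embed (constP (+ 1))

sumQ : (n : ℕ) → (Fin n → QX) → QX
sumQ zero    f = 0Q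
sumQ (suc n) f = f Fin.zero +Q sumQ n (λ k → f (Fin.suc k))

-- The sums over h are truncated at
-- h ≤ j+2; all terms with h > j+1 vanish (the top index is < bottom index,
-- and h < 0 gives bottom index < 0), so these are exactly the stated sums.

polySum : ℕ → (ℕ → ℕ) → Poly
polySum bound f = applyUpTo (λ h → + f h) (suc bound)

a b c : ℕ → Poly
a j = polySum (j ℕ.+ 2) (λ h → (j ℕ.+ 1 ℕ.+ h) C (2 ℕ.* h ℕ.+ 1))
b j = polySum (j ℕ.+ 2) (λ h → (j ℕ.+ 1 ℕ.+ h) C (2 ℕ.* h))
c j = polySum (j ℕ.+ 2) (λ h → (j ℕ.+ 2 ℕ.+ h) C (2 ℕ.* h ℕ.+ 1))

-- sanity: a_j and c_j are nonzero (constant terms j+1 and j+2)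
aNZ : ∀ j → ¬ (a j ≈P [])
aNZ j eq with eq 0
... | e rewrite +-identityʳ (j ℕ.+ 1) | nC1≡n (j ℕ.+ 1) | Data.Nat.Properties.+-comm j 1 with e
...   | ()

cNZ : ∀ j → ¬ (c j ≈P [])
cNZ j eq with eq 0
... | e rewrite +-identityʳ (j ℕ.+ 2) | nC1≡n (j ℕ.+ 2) | Data.Nat.Properties.+-comm j 2 with e
...   | ()

Mat : ℕ → Set
Mat n = Fin n → Fin n → QX

infixl 7 _⊗_
_⊗_ : ∀ {n} → Mat n → Mat n → Mat n
_⊗_ {n} A B i j = sumQ n (λ k → A i k *Q B k j)

M : ∀ n → Mat n
M n i j = embed (constP (+ (toℕ i C toℕ j)) *P Xp
                 +P constP (+ ((toℕ i ℕ.+ 2) C (toℕ j ℕ.+ 1))))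

L : ∀ n → Mat n
L n i j = (constP (+ ((toℕ i ℕ.+ 1) C (toℕ j ℕ.+ 1))) *P a (toℕ j)
           +P constP (+ (toℕ i C toℕ j)) *P b (toℕ j)) / c (toℕ j)

Uent : ℕ → ℕ → QX
Uent j l with l ≟ j
... | yes _ = c j / a j
... | no _ with l ≟ suc j
...   | yes _ = 1Q
...   | no _  = 0Q

U : ∀ n → Mat n
U n j l = Uent (toℕ j) (toℕ l)

LowerUnitriangular : ∀ {n} → Mat n → Set
LowerUnitriangular {n} A =
  (∀ i → A i i ≈ 1Q) × (∀ i j → toℕ i ℕ.< toℕ j → A i j ≈ 0Q)

module Submission where

-- Column j of U has nonzero entries only in rows j−1 (the entry 1) and j
-- (the entry c_j/a_j).  Writing L_{ik} = ℓ_{ik}/c_k (ℓ = numL), entry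
-- (i, j+1) of LU is ℓ_{ij}/c_j + ℓ_{i,j+1}/a_{j+1}, and since c_j = a_{j+1}
-- this is (ℓ_{ij} + ℓ_{i,j+1})/a_{j+1}.  So M = LU reduces to the polynomial
-- identities M_{i0}·a_0 = ℓ_{i0} and M_{i,j+1}·a_{j+1} = ℓ_{ij} + ℓ_{i,j+1},
-- which follow from Pascal's rule and three coefficientwise identities:
-- a_j + b_j = c_j, c_j = a_{j+1} and (1 + X)·a_{j+1} = b_{j+1} + a_j.
-- Unitriangularity is ℓ_{ii} = a_i + b_i = c_i and ℓ_{ij} = 0 for i < j.

open import Defs
open import Function using (_∘_; _$_)
open import Level using (0ℓ)
open import Data.Nat as ℕ using (ℕ; zero; suc; _≥_)
import Data.Nat.Properties as ℕP
open import Data.Integer as ℤ using (ℤ; +_)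
import Data.Integer.Properties as ℤP
import Data.Integer.Tactic.RingSolver as ℤSolver
open import Data.List using ([]; _∷_)
open import Data.Fin using (toℕ)
open import Data.Fin.Properties using (toℕ<n)
open import Data.Maybe using (nothing)
open import Data.Product using (_×_; _,_)
open import Algebra.Bundles using (CommutativeSemiring)
open import Tactic.RingSolver using (solve-∀)
open import Tactic.RingSolver.Core.AlmostCommutativeRing using (AlmostCommutativeRing; fromCommutativeSemiring)
open import Relation.Binary.PropositionalEquality as ≡
  using (_≡_; _≢_; refl; sym; trans; cong; cong₂; module ≡-Reasoning)

1P : Poly
1P = constP (+ 1)

-- A record around _≈P_: unlike the function type it unfolds to, it lets
-- unification (and the reflective ring solver) recover both sides.
infix 4 _≃_
record _≃_ (p q : Poly) : Set where
  constructor mk≃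
  field coeff-≡ : p ≈P q
open _≃_

module _ where
  open import Data.Integer using (_+_; _*_)

  conv : (ℕ → ℤ) → (ℕ → ℤ) → ℕ → ℤ
  conv f g zero    = f 0 * g 0
  conv f g (suc n) = f 0 * g (suc n) + conv (f ∘ suc) g n

  conv-cong : ∀ {f f′ g g′} → (∀ k → f k ≡ f′ k) → (∀ k → g k ≡ g′ k) →
              ∀ n → conv f g n ≡ conv f′ g′ n
  conv-cong f≗f′ g≗g′ zero    = cong₂ _*_ (f≗f′ 0) (g≗g′ 0)
  conv-cong f≗f′ g≗g′ (suc n) =
    cong₂ _+_ (cong₂ _*_ (f≗f′ 0) (g≗g′ (suc n))) (conv-cong (f≗f′ ∘ suc) g≗g′ n)

  conv-zeroˡ : ∀ {f} g → (∀ k → f k ≡ + 0) → ∀ n → conv f g n ≡ + 0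
  conv-zeroˡ g f≗0 zero    rewrite f≗0 0 = refl
  conv-zeroˡ g f≗0 (suc n) rewrite f≗0 0 =
    trans (ℤP.+-identityˡ _) (conv-zeroˡ g (f≗0 ∘ suc) n)

  conv-peel : ∀ f g n → conv f g (suc n) ≡ g 0 * f (suc n) + conv f (g ∘ suc) n
  conv-peel f g zero    = trans (cong (_+_ (f 0 * g 1)) (ℤP.*-comm (f 1) (g 0)))
                                (ℤP.+-comm (f 0 * g 1) (g 0 * f 1))
  conv-peel f g (suc n) = begin
    f 0 * g (2 ℕ.+ n) + conv (f ∘ suc) g (suc n)
      ≡⟨ cong (_+_ (f 0 * g (2 ℕ.+ n))) (conv-peel (f ∘ suc) g n) ⟩
    f 0 * g (2 ℕ.+ n) + (g 0 * f (2 ℕ.+ n) + conv (f ∘ suc) (g ∘ suc) n)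
      ≡⟨ swap (f 0 * g (2 ℕ.+ n)) (g 0 * f (2 ℕ.+ n)) _ ⟩
    g 0 * f (2 ℕ.+ n) + (f 0 * g (2 ℕ.+ n) + conv (f ∘ suc) (g ∘ suc) n)
      ∎
    where
    open ≡-Reasoning
    swap : ∀ x y z → x + (y + z) ≡ y + (x + z)
    swap = ℤSolver.solve-∀

  conv-comm : ∀ f g n → conv f g n ≡ conv g f n
  conv-comm f g zero    = ℤP.*-comm (f 0) (g 0)
  conv-comm f g (suc n) =
    trans (cong (_+_ (f 0 * g (suc n))) (conv-comm (f ∘ suc) g n)) (sym (conv-peel g f n))

  conv-distribʳ : ∀ f f′ g n → conv (λ k → f k + f′ k) g n ≡ conv f g n + conv f′ g n
  conv-distribʳ f f′ g zero    = ℤP.*-distribʳ-+ (g 0) (f 0) (f′ 0)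
  conv-distribʳ f f′ g (suc n) = begin
    (f 0 + f′ 0) * g (suc n) + conv (λ k → f (suc k) + f′ (suc k)) g n
      ≡⟨ cong (_+_ ((f 0 + f′ 0) * g (suc n))) (conv-distribʳ (f ∘ suc) (f′ ∘ suc) g n) ⟩
    (f 0 + f′ 0) * g (suc n) + (conv (f ∘ suc) g n + conv (f′ ∘ suc) g n)
      ≡⟨ regroup (f 0) (f′ 0) (g (suc n)) _ _ ⟩
    (f 0 * g (suc n) + conv (f ∘ suc) g n) + (f′ 0 * g (suc n) + conv (f′ ∘ suc) g n)
      ∎
    where
    open ≡-Reasoning
    regroup : ∀ x x′ y s s′ → (x + x′) * y + (s + s′) ≡ (x * y + s) + (x′ * y + s′)
    regroup = ℤSolver.solve-∀

  conv-scaleˡ : ∀ r f g n → conv (λ k → r * f k) g n ≡ r * conv f g n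
  conv-scaleˡ r f g zero    = ℤP.*-assoc r (f 0) (g 0)
  conv-scaleˡ r f g (suc n) = begin
    r * f 0 * g (suc n) + conv (λ k → r * f (suc k)) g n
      ≡⟨ cong (_+_ (r * f 0 * g (suc n))) (conv-scaleˡ r (f ∘ suc) g n) ⟩
    r * f 0 * g (suc n) + r * conv (f ∘ suc) g n
      ≡⟨ factor r (f 0) (g (suc n)) _ ⟩
    r * (f 0 * g (suc n) + conv (f ∘ suc) g n)
      ∎
    where
    open ≡-Reasoning
    factor : ∀ r x y s → r * x * y + r * s ≡ r * (x * y + s)
    factor = ℤSolver.solve-∀

  conv-assoc : ∀ f g h n → conv (conv f g) h n ≡ conv f (conv g h) n
  conv-assoc f g h zero    = ℤP.*-assoc (f 0) (g 0) (h 0)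
  conv-assoc f g h (suc n) = begin
    f 0 * g 0 * h (suc n) + conv (λ k → f 0 * g (suc k) + conv (f ∘ suc) g k) h n
      ≡⟨ cong (_+_ (f 0 * g 0 * h (suc n))) (conv-distribʳ (λ k → f 0 * g (suc k)) (conv (f ∘ suc) g) h n) ⟩
    f 0 * g 0 * h (suc n) + (conv (λ k → f 0 * g (suc k)) h n + conv (conv (f ∘ suc) g) h n)
      ≡⟨ cong (_+_ (f 0 * g 0 * h (suc n)))
              (cong₂ _+_ (conv-scaleˡ (f 0) (g ∘ suc) h n) (conv-assoc (f ∘ suc) g h n)) ⟩
    f 0 * g 0 * h (suc n) + (f 0 * conv (g ∘ suc) h n + conv (f ∘ suc) (conv g h) n)
      ≡⟨ factor (f 0) (g 0) (h (suc n)) _ _ ⟩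
    f 0 * (g 0 * h (suc n) + conv (g ∘ suc) h n) + conv (f ∘ suc) (conv g h) n
      ∎
    where
    open ≡-Reasoning
    factor : ∀ r x y s t → r * x * y + (r * s + t) ≡ r * (x * y + s) + t
    factor = ℤSolver.solve-∀

  coeff-+P : ∀ p q n → coeff (p +P q) n ≡ coeff p n + coeff q n
  coeff-+P []      q       n       = sym (ℤP.+-identityˡ _)
  coeff-+P (x ∷ p) []      n       = sym (ℤP.+-identityʳ _)
  coeff-+P (x ∷ p) (y ∷ q) zero    = refl
  coeff-+P (x ∷ p) (y ∷ q) (suc n) = coeff-+P p q n

  coeff-scaleP : ∀ r p n → coeff (scaleP r p) n ≡ r * coeff p n
  coeff-scaleP r []      n       = sym (ℤP.*-zeroʳ r)
  coeff-scaleP r (x ∷ p) zero    = refl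
  coeff-scaleP r (x ∷ p) (suc n) = coeff-scaleP r p n

  coeff-*P : ∀ p q n → coeff (p *P q) n ≡ conv (coeff p) (coeff q) n
  coeff-*P []      q n       = sym (conv-zeroˡ (coeff q) (λ _ → refl) n)
  coeff-*P (r ∷ p) q zero    =
    trans (coeff-+P (scaleP r q) (+ 0 ∷ p *P q) 0)
          (trans (ℤP.+-identityʳ _) (coeff-scaleP r q 0))
  coeff-*P (r ∷ p) q (suc n) =
    trans (coeff-+P (scaleP r q) (+ 0 ∷ p *P q) (suc n))
          (cong₂ _+_ (coeff-scaleP r q (suc n)) (coeff-*P p q n))

  conv-identityˡ : ∀ g n → conv (coeff 1P) g n ≡ g n
  conv-identityˡ g zero    = ℤP.*-identityˡ (g 0)
  conv-identityˡ g (suc n) =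
    trans (cong₂ _+_ (ℤP.*-identityˡ (g (suc n))) (conv-zeroˡ g (λ _ → refl) n))
          (ℤP.+-identityʳ (g (suc n)))

  coeff-Xp*P-zero : ∀ p → coeff (Xp *P p) 0 ≡ + 0
  coeff-Xp*P-zero p = coeff-*P Xp p 0

  coeff-Xp*P-suc : ∀ p n → coeff (Xp *P p) (suc n) ≡ coeff p n
  coeff-Xp*P-suc p n =
    trans (coeff-*P Xp p (suc n)) (trans (ℤP.+-identityˡ _) (conv-identityˡ (coeff p) n))

  ≃-refl : ∀ {p} → p ≃ p
  ≃-refl = mk≃ λ _ → refl

  ≃-sym : ∀ {p q} → p ≃ q → q ≃ p
  ≃-sym (mk≃ p≈q) = mk≃ λ n → sym (p≈q n)

  ≃-trans : ∀ {p q r} → p ≃ q → q ≃ r → p ≃ r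
  ≃-trans (mk≃ p≈q) (mk≃ q≈r) = mk≃ λ n → trans (p≈q n) (q≈r n)

  +P-cong : ∀ {p p′ q q′} → p ≃ p′ → q ≃ q′ → p +P q ≃ p′ +P q′
  +P-cong {p} {p′} {q} {q′} (mk≃ p≈p′) (mk≃ q≈q′) = mk≃ λ n →
    trans (coeff-+P p q n) (trans (cong₂ _+_ (p≈p′ n) (q≈q′ n)) (sym (coeff-+P p′ q′ n)))

  +P-assoc : ∀ p q r → (p +P q) +P r ≃ p +P (q +P r)
  +P-assoc p q r = mk≃ λ n → begin
    coeff ((p +P q) +P r) n              ≡⟨ coeff-+P (p +P q) r n ⟩
    coeff (p +P q) n + coeff r n         ≡⟨ cong (_+ coeff r n) (coeff-+P p q n) ⟩
    coeff p n + coeff q n + coeff r n    ≡⟨ ℤP.+-assoc (coeff p n) (coeff q n) (coeff r n) ⟩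
    coeff p n + (coeff q n + coeff r n)  ≡⟨ cong (_+_ (coeff p n)) (coeff-+P q r n) ⟨
    coeff p n + coeff (q +P r) n         ≡⟨ coeff-+P p (q +P r) n ⟨
    coeff (p +P (q +P r)) n              ∎
    where open ≡-Reasoning

  +P-comm : ∀ p q → p +P q ≃ q +P p
  +P-comm p q = mk≃ λ n →
    trans (coeff-+P p q n) (trans (ℤP.+-comm (coeff p n) (coeff q n)) (sym (coeff-+P q p n)))

  *P-cong : ∀ {p p′ q q′} → p ≃ p′ → q ≃ q′ → p *P q ≃ p′ *P q′
  *P-cong {p} {p′} {q} {q′} (mk≃ p≈p′) (mk≃ q≈q′) = mk≃ λ n →
    trans (coeff-*P p q n) (trans (conv-cong p≈p′ q≈q′ n) (sym (coeff-*P p′ q′ n)))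

  *P-comm : ∀ p q → p *P q ≃ q *P p
  *P-comm p q = mk≃ λ n →
    trans (coeff-*P p q n) (trans (conv-comm (coeff p) (coeff q) n) (sym (coeff-*P q p n)))

  *P-assoc : ∀ p q r → (p *P q) *P r ≃ p *P (q *P r)
  *P-assoc p q r = mk≃ λ n → begin
    coeff ((p *P q) *P r) n                      ≡⟨ coeff-*P (p *P q) r n ⟩
    conv (coeff (p *P q)) (coeff r) n            ≡⟨ conv-cong (coeff-*P p q) (λ _ → refl) n ⟩
    conv (conv (coeff p) (coeff q)) (coeff r) n  ≡⟨ conv-assoc (coeff p) (coeff q) (coeff r) n ⟩
    conv (coeff p) (conv (coeff q) (coeff r)) n  ≡⟨ conv-cong (λ _ → refl) (coeff-*P q r) n ⟨
    conv (coeff p) (coeff (q *P r)) n            ≡⟨ coeff-*P p (q *P r) n ⟨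
    coeff (p *P (q *P r)) n                      ∎
    where open ≡-Reasoning

  *P-identityˡ : ∀ p → 1P *P p ≃ p
  *P-identityˡ p = mk≃ λ n → trans (coeff-*P 1P p n) (conv-identityˡ (coeff p) n)

  *P-distribʳ : ∀ p q r → (q +P r) *P p ≃ q *P p +P r *P p
  *P-distribʳ p q r = mk≃ λ n → begin
    coeff ((q +P r) *P p) n                                   ≡⟨ coeff-*P (q +P r) p n ⟩
    conv (coeff (q +P r)) (coeff p) n                         ≡⟨ conv-cong (coeff-+P q r) (λ _ → refl) n ⟩
    conv (λ k → coeff q k + coeff r k) (coeff p) n            ≡⟨ conv-distribʳ (coeff q) (coeff r) (coeff p) n ⟩
    conv (coeff q) (coeff p) n + conv (coeff r) (coeff p) n   ≡⟨ cong₂ _+_ (coeff-*P q p n) (coeff-*P r p n) ⟨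
    coeff (q *P p) n + coeff (r *P p) n                       ≡⟨ coeff-+P (q *P p) (r *P p) n ⟨
    coeff (q *P p +P r *P p) n                                ∎
    where open ≡-Reasoning

open import Algebra.Structures _≃_ using (IsSemigroup)
open import Algebra.Structures.Biased _≃_ using (isCommutativeMonoidˡ; IsCommutativeSemiringˡ)

private
  ≃-isSemigroup : ∀ {_∙_} → (∀ {p p′ q q′} → p ≃ p′ → q ≃ q′ → (p ∙ q) ≃ (p′ ∙ q′)) →
              (∀ p q r → ((p ∙ q) ∙ r) ≃ (p ∙ (q ∙ r))) → IsSemigroup _∙_
  ≃-isSemigroup ∙-cong assoc = record
    { isMagma = record
      { isEquivalence = record { refl = ≃-refl ; sym = ≃-sym ; trans = ≃-trans }
      ; ∙-cong = ∙-cong }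
    ; assoc = assoc }

polySemiring : CommutativeSemiring 0ℓ 0ℓ
polySemiring = record
  { isCommutativeSemiring = IsCommutativeSemiringˡ.isCommutativeSemiring {_+P_} {_*P_} {[]} {1P} record
    { +-isCommutativeMonoid = isCommutativeMonoidˡ {_+P_} {[]} record
      { isSemigroup = ≃-isSemigroup +P-cong +P-assoc ; identityˡ = λ _ → ≃-refl ; comm = +P-comm }
    ; *-isCommutativeMonoid = isCommutativeMonoidˡ {_*P_} {1P} record
      { isSemigroup = ≃-isSemigroup *P-cong *P-assoc ; identityˡ = *P-identityˡ ; comm = *P-comm }
    ; distribʳ = *P-distribʳ
    ; zeroˡ = λ _ → ≃-refl } }

polyRing : AlmostCommutativeRing 0ℓ 0ℓ
polyRing = fromCommutativeSemiring polySemiring (λ _ → nothing)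

+P-congˡ : ∀ p {q q′} → q ≃ q′ → p +P q ≃ p +P q′
+P-congˡ p = +P-cong (≃-refl {p})

+P-congʳ : ∀ r {p p′} → p ≃ p′ → p +P r ≃ p′ +P r
+P-congʳ r p≃p′ = +P-cong p≃p′ (≃-refl {r})

*P-congˡ : ∀ p {q q′} → q ≃ q′ → p *P q ≃ p *P q′
*P-congˡ p = *P-cong (≃-refl {p})

*P-congʳ : ∀ r {p p′} → p ≃ p′ → p *P r ≃ p′ *P r
*P-congʳ r p≃p′ = *P-cong p≃p′ (≃-refl {r})

constP-cong : ∀ {x y} → x ≡ y → constP (+ x) ≃ constP (+ y)
constP-cong refl = ≃-refl

constP-+ : ∀ x y → constP (+ (x ℕ.+ y)) ≃ constP (+ x) +P constP (+ y)
constP-+ x y = mk≃ λ { zero → ℤP.pos-+ x y ; (suc n) → refl }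

constP-0 : constP (+ 0) ≃ []
constP-0 = mk≃ λ { zero → refl ; (suc n) → refl }

module _ where
  open import Data.Nat using (_+_; _*_; _<_; _≤_; s≤s; z≤n)
  import Data.Nat.Tactic.RingSolver as ℕSolver
  open import Data.Nat.Combinatorics using (_C_; nCk+nC[k+1]≡[n+1]C[k+1]; k>n⇒nCk≡0)
  open import Data.List using (applyUpTo)

  coeff-applyUpTo : ∀ (f : ℕ → ℤ) n → (∀ h → n ≤ h → f h ≡ + 0) →
                    ∀ h → coeff (applyUpTo f n) h ≡ f h
  coeff-applyUpTo f zero    f≡0 h       = sym (f≡0 h z≤n)
  coeff-applyUpTo f (suc n) f≡0 zero    = refl
  coeff-applyUpTo f (suc n) f≡0 (suc h) = coeff-applyUpTo (f ∘ suc) n (λ h → f≡0 (suc h) ∘ s≤s) h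

  coeff-polySum : ∀ bound f → (∀ h → bound < h → f h ≡ 0) →
                  ∀ h → coeff (polySum bound f) h ≡ + f h
  coeff-polySum bound f f≡0 = coeff-applyUpTo (λ h → + f h) (suc bound) (λ h → cong +_ ∘ f≡0 h)

  binomial-vanishes : ∀ {m h k} → m < h → 2 * h ≤ k → (m + h) C k ≡ 0
  binomial-vanishes {m} {h} m<h 2h≤k = k>n⇒nCk≡0 (ℕP.<-≤-trans m+h<2h 2h≤k)
    where
    m+h<2h : m + h < 2 * h
    m+h<2h = ℕP.<-≤-trans (ℕP.+-monoˡ-< h m<h) (ℕP.≤-reflexive (h+h≡2*h h))
      where
      h+h≡2*h : ∀ h → h + h ≡ 2 * h
      h+h≡2*h = ℕSolver.solve-∀

  aCoeff bCoeff cCoeff : ℕ → ℕ → ℕ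
  aCoeff j h = (j + 1 + h) C (2 * h + 1)
  bCoeff j h = (j + 1 + h) C (2 * h)
  cCoeff j h = (j + 2 + h) C (2 * h + 1)

  private
    j+1<h : ∀ {j h} → j + 2 < h → j + 1 < h
    j+1<h {j} = ℕP.<-trans (ℕP.+-monoʳ-< j (ℕP.n<1+n 1))

  coeff-a : ∀ j h → coeff (a j) h ≡ + aCoeff j h
  coeff-a j = coeff-polySum (j + 2) (aCoeff j) λ h j+2<h →
    binomial-vanishes (j+1<h j+2<h) (ℕP.m≤m+n (2 * h) 1)

  coeff-b : ∀ j h → coeff (b j) h ≡ + bCoeff j h
  coeff-b j = coeff-polySum (j + 2) (bCoeff j) λ h j+2<h →
    binomial-vanishes (j+1<h j+2<h) ℕP.≤-refl

  coeff-c : ∀ j h → coeff (c j) h ≡ + cCoeff j h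
  coeff-c j = coeff-polySum (j + 2) (cCoeff j) λ h j+2<h →
    binomial-vanishes j+2<h (ℕP.m≤m+n (2 * h) 1)

  pascal : ∀ n k → suc n C suc k ≡ n C k + n C suc k
  pascal n k = sym (nCk+nC[k+1]≡[n+1]C[k+1] n k)

  pascal-shift : ∀ n k → suc n C (2 + k) + n C k ≡ suc n C suc k + n C (2 + k)
  pascal-shift n k = begin
    suc n C (2 + k) + n C k                ≡⟨ ℕP.+-comm (suc n C (2 + k)) (n C k) ⟩
    n C k + suc n C (2 + k)                ≡⟨ cong (_+_ (n C k)) (pascal n (suc k)) ⟩
    n C k + (n C suc k + n C (2 + k))      ≡⟨ ℕP.+-assoc (n C k) _ _ ⟨
    n C k + n C suc k + n C (2 + k)        ≡⟨ cong (_+ (n C (2 + k))) (pascal n k) ⟨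
    suc n C suc k + n C (2 + k)            ∎
    where open ≡-Reasoning

  aCoeff+bCoeff≡cCoeff : ∀ j h → aCoeff j h + bCoeff j h ≡ cCoeff j h
  aCoeff+bCoeff≡cCoeff j h = begin
    N C (2 * h + 1) + N C (2 * h)   ≡⟨ ℕP.+-comm (N C (2 * h + 1)) _ ⟩
    N C (2 * h) + N C (2 * h + 1)   ≡⟨ cong (λ k → N C (2 * h) + N C k) (ℕP.+-comm (2 * h) 1) ⟩
    N C (2 * h) + N C suc (2 * h)   ≡⟨ pascal N (2 * h) ⟨
    suc N C suc (2 * h)             ≡⟨ cong₂ _C_ (suc[j+1+h]≡j+2+h j h) (ℕP.+-comm 1 (2 * h)) ⟩
    cCoeff j h                      ∎
    where
    open ≡-Reasoning
    N = j + 1 + h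
    suc[j+1+h]≡j+2+h : ∀ j h → suc (j + 1 + h) ≡ j + 2 + h
    suc[j+1+h]≡j+2+h = ℕSolver.solve-∀

  cCoeff≡aCoeff-suc : ∀ j h → cCoeff j h ≡ aCoeff (suc j) h
  cCoeff≡aCoeff-suc j h = cong (_C (2 * h + 1)) (j+2+h≡suc[j]+1+h j h)
    where
    j+2+h≡suc[j]+1+h : ∀ j h → j + 2 + h ≡ suc j + 1 + h
    j+2+h≡suc[j]+1+h = ℕSolver.solve-∀

  aCoeff-suc-zero : ∀ j → aCoeff (suc j) 0 ≡ bCoeff (suc j) 0 + aCoeff j 0
  aCoeff-suc-zero j = pascal (j + 1 + 0) 0

  aCoeff-suc-suc : ∀ j g →
    aCoeff (suc j) (suc g) + aCoeff (suc j) g ≡ bCoeff (suc j) (suc g) + aCoeff j (suc g)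
  aCoeff-suc-suc j g = begin
    aCoeff (suc j) (suc g) + aCoeff (suc j) g  ≡⟨ cong₂ _+_ (cong₂ _C_ top₂ bot₂) (cong (_C k) top₁) ⟩
    suc N C (2 + k) + N C k                    ≡⟨ pascal-shift N k ⟩
    suc N C suc k + N C (2 + k)                ≡⟨ cong₂ _+_ (cong₂ _C_ top₂ bot₁) (cong₂ _C_ top₃ bot₂) ⟨
    bCoeff (suc j) (suc g) + aCoeff j (suc g)  ∎
    where
    open ≡-Reasoning
    N = j + 2 + g
    k = 2 * g + 1
    top₁ : suc j + 1 + g ≡ j + 2 + g
    top₁ = ℕSolver.solve (j ∷ g ∷ [])
    top₂ : suc j + 1 + suc g ≡ suc (j + 2 + g)
    top₂ = ℕSolver.solve (j ∷ g ∷ [])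
    top₃ : j + 1 + suc g ≡ j + 2 + g
    top₃ = ℕSolver.solve (j ∷ g ∷ [])
    bot₁ : 2 * suc g ≡ suc (2 * g + 1)
    bot₁ = ℕSolver.solve (g ∷ [])
    bot₂ : 2 * suc g + 1 ≡ 2 + (2 * g + 1)
    bot₂ = ℕSolver.solve (g ∷ [])

  a+b≃c : ∀ j → a j +P b j ≃ c j
  a+b≃c j = mk≃ λ h → begin
    coeff (a j +P b j) h                 ≡⟨ coeff-+P (a j) (b j) h ⟩
    coeff (a j) h ℤ.+ coeff (b j) h      ≡⟨ cong₂ ℤ._+_ (coeff-a j h) (coeff-b j h) ⟩
    + aCoeff j h ℤ.+ + bCoeff j h        ≡⟨ ℤP.pos-+ (aCoeff j h) (bCoeff j h) ⟨
    + (aCoeff j h + bCoeff j h)          ≡⟨ cong +_ (aCoeff+bCoeff≡cCoeff j h) ⟩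
    + cCoeff j h                         ≡⟨ coeff-c j h ⟨
    coeff (c j) h                        ∎
    where open ≡-Reasoning

  c≃a-suc : ∀ j → c j ≃ a (suc j)
  c≃a-suc j = mk≃ λ h →
    trans (coeff-c j h) (trans (cong +_ (cCoeff≡aCoeff-suc j h)) (sym (coeff-a (suc j) h)))

  a+Xa≃b+a : ∀ j → a (suc j) +P Xp *P a (suc j) ≃ b (suc j) +P a j
  a+Xa≃b+a j = mk≃ λ h → begin
    coeff (a (suc j) +P Xp *P a (suc j)) h               ≡⟨ coeff-+P (a (suc j)) (Xp *P a (suc j)) h ⟩
    coeff (a (suc j)) h ℤ.+ coeff (Xp *P a (suc j)) h    ≡⟨ coeffwise h ⟩
    + bCoeff (suc j) h ℤ.+ + aCoeff j h                  ≡⟨ cong₂ ℤ._+_ (coeff-b (suc j) h) (coeff-a j h) ⟨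
    coeff (b (suc j)) h ℤ.+ coeff (a j) h                ≡⟨ coeff-+P (b (suc j)) (a j) h ⟨
    coeff (b (suc j) +P a j) h                           ∎
    where
    open ≡-Reasoning
    coeffwise : ∀ h →
      coeff (a (suc j)) h ℤ.+ coeff (Xp *P a (suc j)) h ≡ + bCoeff (suc j) h ℤ.+ + aCoeff j h
    coeffwise zero    = begin
      coeff (a (suc j)) 0 ℤ.+ coeff (Xp *P a (suc j)) 0
        ≡⟨ cong₂ ℤ._+_ (coeff-a (suc j) 0) (coeff-Xp*P-zero (a (suc j))) ⟩
      + aCoeff (suc j) 0 ℤ.+ + 0                         ≡⟨ ℤP.+-identityʳ _ ⟩
      + aCoeff (suc j) 0                                 ≡⟨ cong +_ (aCoeff-suc-zero j) ⟩
      + (bCoeff (suc j) 0 + aCoeff j 0)                  ≡⟨ ℤP.pos-+ (bCoeff (suc j) 0) (aCoeff j 0) ⟩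
      + bCoeff (suc j) 0 ℤ.+ + aCoeff j 0                ∎
    coeffwise (suc g) = begin
      coeff (a (suc j)) (suc g) ℤ.+ coeff (Xp *P a (suc j)) (suc g)
        ≡⟨ cong₂ ℤ._+_ (coeff-a (suc j) (suc g)) (trans (coeff-Xp*P-suc (a (suc j)) g) (coeff-a (suc j) g)) ⟩
      + aCoeff (suc j) (suc g) ℤ.+ + aCoeff (suc j) g
        ≡⟨ ℤP.pos-+ (aCoeff (suc j) (suc g)) (aCoeff (suc j) g) ⟨
      + (aCoeff (suc j) (suc g) + aCoeff (suc j) g)
        ≡⟨ cong +_ (aCoeff-suc-suc j g) ⟩
      + (bCoeff (suc j) (suc g) + aCoeff j (suc g))
        ≡⟨ ℤP.pos-+ (bCoeff (suc j) (suc g)) (aCoeff j (suc g)) ⟩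
      + bCoeff (suc j) (suc g) ℤ.+ + aCoeff j (suc g)     ∎

open CommutativeSemiring polySemiring using (setoid; +-identityʳ; *-identityʳ; zeroʳ)
open import Relation.Binary.Reasoning.Setoid setoid

Null : QX → Set
Null f = num f ≃ []

-- Sums are compared through ∝ rather than _≈_, which on formal fractions
-- is transitive only after cancelling nonzero factors.
infix 4 _∝_
record _∝_ (f g : QX) : Set where
  constructor rescaled
  field
    factor : Poly
    num-≃  : num f ≃ num g *P factor
    den-≃  : den f ≃ den g *P factor

∝-refl : ∀ f → f ∝ f
∝-refl f = rescaled 1P (≃-sym (*-identityʳ (num f))) (≃-sym (*-identityʳ (den f)))

∝-trans : ∀ {f g h} → f ∝ g → g ∝ h → f ∝ h
∝-trans {f} {g} {h} (rescaled e nf df) (rescaled e′ ng dg) =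
  rescaled (e′ *P e) (rescale (num f) (num h) nf ng) (rescale (den f) (den h) df dg)
  where
  rescale : ∀ x {y} z → x ≃ y *P e → y ≃ z *P e′ → x ≃ z *P (e′ *P e)
  rescale x {y} z x≃ye y≃ze′ = begin
    x               ≈⟨ x≃ye ⟩
    y *P e          ≈⟨ *P-congʳ e y≃ze′ ⟩
    z *P e′ *P e    ≈⟨ *P-assoc z e′ e ⟩
    z *P (e′ *P e)  ∎

+Q-cong-∝ : ∀ {f f′ g g′} → f ∝ f′ → g ∝ g′ → f +Q g ∝ f′ +Q g′
+Q-cong-∝ {p / q} {p′ / q′} {r / s} {r′ / s′} (rescaled e p≃ q≃) (rescaled e′ r≃ s≃) =
  rescaled (e *P e′)
  (begin
    p *P s +P r *P q                               ≈⟨ +P-cong (*P-cong p≃ s≃) (*P-cong r≃ q≃) ⟩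
    p′ *P e *P (s′ *P e′) +P r′ *P e′ *P (q′ *P e) ≈⟨ factor p′ e s′ e′ r′ q′ ⟩
    (p′ *P s′ +P r′ *P q′) *P (e *P e′)            ∎)
  (begin
    q *P s                    ≈⟨ *P-cong q≃ s≃ ⟩
    q′ *P e *P (s′ *P e′)     ≈⟨ interchange q′ e s′ e′ ⟩
    q′ *P s′ *P (e *P e′)     ∎)
  where
  factor : ∀ p e s e′ r q → p *P e *P (s *P e′) +P r *P e′ *P (q *P e) ≃ (p *P s +P r *P q) *P (e *P e′)
  factor = solve-∀ polyRing
  interchange : ∀ q e s e′ → q *P e *P (s *P e′) ≃ q *P s *P (e *P e′)
  interchange = solve-∀ polyRing

+Q-identityʳ-∝ : ∀ f {g} → Null g → f +Q g ∝ f
+Q-identityʳ-∝ (p / q) {r / s} r≃0 = rescaled s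
  (begin p *P s +P r *P q ≈⟨ +P-congˡ (p *P s) (*P-congʳ q r≃0) ⟩
         p *P s +P []     ≈⟨ +-identityʳ (p *P s) ⟩
         p *P s           ∎)
  ≃-refl

+Q-identityˡ-∝ : ∀ {f} g → Null f → f +Q g ∝ g
+Q-identityˡ-∝ {p / q} (r / s) p≃0 =
  rescaled q (+P-congʳ (r *P q) (*P-congʳ s p≃0)) (*P-comm q s)

≈-∝-trans : ∀ f {g h} → f ≈ g → h ∝ g → f ≈ h
≈-∝-trans (p / q) {r / s} {t / u} pu≈rq (rescaled e t≃ u≃) = coeff-≡ $ begin
    p *P u          ≈⟨ *P-congˡ p u≃ ⟩
    p *P (s *P e)   ≈⟨ *P-assoc p s e ⟨
    p *P s *P e     ≈⟨ *P-congʳ e (mk≃ {p *P s} {r *P q} pu≈rq) ⟩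
    r *P q *P e     ≈⟨ swap r q e ⟩
    r *P e *P q     ≈⟨ *P-congʳ q t≃ ⟨
    t *P q          ∎
  where
  swap : ∀ r q e → r *P q *P e ≃ r *P e *P q
  swap = solve-∀ polyRing

sumN : (ℕ → QX) → ℕ → QX
sumN F zero    = 0Q
sumN F (suc n) = F 0 +Q sumN (F ∘ suc) n

sumQ≡sumN : ∀ n (F : ℕ → QX) → sumQ n (F ∘ toℕ) ≡ sumN F n
sumQ≡sumN zero    F = refl
sumQ≡sumN (suc n) F = cong (F 0 +Q_) (sumQ≡sumN n (F ∘ suc))

sumN-null : ∀ n {F} → (∀ m → Null (F m)) → Null (sumN F n)
sumN-null zero    F-null = ≃-refl
sumN-null (suc n) F-null =
  +P-cong (*P-cong (F-null 0) ≃-refl) (*P-cong (sumN-null n (F-null ∘ suc)) ≃-refl)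

sumN-single : ∀ n F → (∀ m → Null (F (suc m))) → sumN F (suc n) ∝ F 0
sumN-single n F F-null = +Q-identityʳ-∝ (F 0) (sumN-null n F-null)

sumN-window : ∀ j n F → (∀ m → m ℕ.< j → Null (F m)) → (∀ m → Null (F (2 ℕ.+ j ℕ.+ m))) →
              sumN F (2 ℕ.+ j ℕ.+ n) ∝ F j +Q F (suc j)
sumN-window zero    n F _      F-null = +Q-cong-∝ (∝-refl (F 0)) (sumN-single n (F ∘ suc) F-null)
sumN-window (suc j) n F F-null F-null′ = ∝-trans
  (+Q-identityˡ-∝ (sumN (F ∘ suc) (2 ℕ.+ j ℕ.+ n)) (F-null 0 (ℕ.s≤s ℕ.z≤n)))
  (sumN-window j n (F ∘ suc) (λ m → F-null (suc m) ∘ ℕ.s≤s) F-null′)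

null-*Q-0Q : ∀ f → Null (f *Q 0Q)
null-*Q-0Q (p / q) = zeroʳ p

embed≈q/c*c/a : ∀ p q {c a u} → p *P a ≃ q → u ≡ c / a → embed p ≈ (q / c) *Q u
embed≈q/c*c/a p q {c} {a} pa≃q refl = coeff-≡ $ begin
  p *P (c *P a)    ≈⟨ rearrange p c a ⟩
  p *P a *P c      ≈⟨ *P-congʳ c pa≃q ⟩
  q *P c           ≈⟨ *-identityʳ (q *P c) ⟨
  q *P c *P 1P     ∎
  where
  rearrange : ∀ p c a → p *P (c *P a) ≃ p *P a *P c
  rearrange = solve-∀ polyRing

embed≈q/c′*1+r/c*c/a : ∀ p q r {c′ c a u′ u} → p *P a ≃ q +P r → c′ ≃ a → u′ ≡ 1Q → u ≡ c / a →
                       embed p ≈ (q / c′) *Q u′ +Q (r / c) *Q u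
embed≈q/c′*1+r/c*c/a p q r {c′} {c} {a} pa≃q+r c′≃a refl refl = coeff-≡ $ begin
  p *P (c′ *P 1P *P (c *P a))                          ≈⟨ *P-congˡ p (*P-congʳ (c *P a) (*P-congʳ 1P c′≃a)) ⟩
  p *P (a *P 1P *P (c *P a))                           ≈⟨ regroup p a c ⟩
  p *P a *P (c *P a)                                   ≈⟨ *P-congʳ (c *P a) pa≃q+r ⟩
  (q +P r) *P (c *P a)                                 ≈⟨ expand q r c a ⟩
  (q *P 1P *P (c *P a) +P r *P c *P (a *P 1P)) *P 1P
    ≈⟨ *P-congʳ 1P (+P-congˡ (q *P 1P *P (c *P a)) (*P-congˡ (r *P c) (*P-congʳ 1P c′≃a))) ⟨
  (q *P 1P *P (c *P a) +P r *P c *P (c′ *P 1P)) *P 1P  ∎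
  where
  regroup : ∀ p a c → p *P (a *P 1P *P (c *P a)) ≃ p *P a *P (c *P a)
  regroup = solve-∀ polyRing
  expand : ∀ q r c a → (q +P r) *P (c *P a) ≃ (q *P 1P *P (c *P a) +P r *P c *P (a *P 1P)) *P 1P
  expand = solve-∀ polyRing

module _ where
  open import Data.Nat using (_+_; _<_; s≤s)
  open import Data.Nat.Combinatorics using (_C_; nC1≡n; nCn≡1; k>n⇒nCk≡0)
  open import Relation.Nullary using (yes; no)
  open import Data.Empty using (⊥-elim)

  numL : ℕ → ℕ → Poly
  numL i m = constP (+ ((i + 1) C (m + 1))) *P a m +P constP (+ (i C m)) *P b m

  polyM : ℕ → ℕ → Poly
  polyM i j = constP (+ (i C j)) *P Xp +P constP (+ ((i + 2) C (j + 1)))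

  entryL : ℕ → ℕ → QX
  entryL i m = numL i m / c m

  Uent-diag : ∀ m → Uent m m ≡ c m / a m
  Uent-diag m with m ℕ.≟ m
  ... | yes _  = refl
  ... | no m≢m = ⊥-elim (m≢m refl)

  Uent-super : ∀ m → Uent m (suc m) ≡ 1Q
  Uent-super m with suc m ℕ.≟ m
  ... | yes 1+m≡m = ⊥-elim (ℕP.1+n≢n 1+m≡m)
  ... | no _ with suc m ℕ.≟ suc m
  ...   | yes _      = refl
  ...   | no 1+m≢1+m = ⊥-elim (1+m≢1+m refl)

  Uent-off : ∀ m l → l ≢ m → l ≢ suc m → Uent m l ≡ 0Q
  Uent-off m l l≢m l≢1+m with l ℕ.≟ m
  ... | yes l≡m = ⊥-elim (l≢m l≡m)
  ... | no _ with l ℕ.≟ suc m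
  ...   | yes l≡1+m = ⊥-elim (l≢1+m l≡1+m)
  ...   | no _      = refl

  numL-diag : ∀ i → numL i i ≃ c i
  numL-diag i = begin
    numL i i                  ≈⟨ +P-cong (*P-congʳ (a i) (constP-cong (nCn≡1 (i + 1))))
                                         (*P-congʳ (b i) (constP-cong (nCn≡1 i))) ⟩
    1P *P a i +P 1P *P b i    ≈⟨ +P-cong (*P-identityˡ (a i)) (*P-identityˡ (b i)) ⟩
    a i +P b i                ≈⟨ a+b≃c i ⟩
    c i                       ∎

  numL-upper : ∀ {i j} → i < j → numL i j ≃ []
  numL-upper {i} {j} i<j = begin
    numL i j                  ≈⟨ +P-cong (*P-congʳ (a j) (vanishes (ℕP.+-monoˡ-< 1 i<j)))
                                         (*P-congʳ (b j) (vanishes i<j)) ⟩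
    [] *P a j +P [] *P b j    ∎
    where
    vanishes : ∀ {n k} → n < k → constP (+ (n C k)) ≃ []
    vanishes n<k = ≃-trans (constP-cong (k>n⇒nCk≡0 n<k)) constP-0

  polyM*a≃numL : ∀ i → polyM i 0 *P a 0 ≃ numL i 0
  polyM*a≃numL i = begin
    polyM i 0 *P a 0                ≈⟨ *P-cong (+P-congˡ (1P *P Xp) [i+2]C1≃w+1) a₀≃1 ⟩
    (1P *P Xp +P (w +P 1P)) *P 1P   ≈⟨ rearrange w Xp ⟩
    w *P 1P +P 1P *P (1P +P Xp)
      ≈⟨ +P-cong (*P-cong [i+1]C1≃w (≃-sym a₀≃1)) (*P-congˡ 1P (≃-sym b₀≃1+X)) ⟩
    numL i 0                        ∎
    where
    w = constP (+ (i + 1))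
    [i+2]C1≃w+1 : constP (+ ((i + 2) C 1)) ≃ w +P 1P
    [i+2]C1≃w+1 = ≃-trans (constP-cong (trans (nC1≡n (i + 2)) (sym (ℕP.+-assoc i 1 1))))
                          (constP-+ (i + 1) 1)
    [i+1]C1≃w : w ≃ constP (+ ((i + 1) C 1))
    [i+1]C1≃w = constP-cong (sym (nC1≡n (i + 1)))
    a₀≃1 : a 0 ≃ 1P
    a₀≃1 = mk≃ λ { 0 → refl ; 1 → refl ; 2 → refl ; (suc (suc (suc n))) → refl }
    b₀≃1+X : b 0 ≃ 1P +P Xp
    b₀≃1+X = mk≃ λ { 0 → refl ; 1 → refl ; 2 → refl ; (suc (suc (suc n))) → refl }
    rearrange : ∀ w X → (1P *P X +P (w +P 1P)) *P 1P ≃ w *P 1P +P 1P *P (1P +P X)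
    rearrange = solve-∀ polyRing

  polyM*a≃numL+numL : ∀ i j → polyM i (suc j) *P a (suc j) ≃ numL i j +P numL i (suc j)
  polyM*a≃numL+numL i j = begin
    polyM i (suc j) *P A                             ≈⟨ *P-congʳ A (+P-congˡ (u *P Xp) p≃v+[z+u]) ⟩
    (u *P Xp +P (v +P (z +P u))) *P A                ≈⟨ distribute u Xp v z A ⟩
    u *P (A +P Xp *P A) +P v *P A +P z *P A          ≈⟨ +P-cong (+P-congʳ (v *P A) (*P-congˡ u (a+Xa≃b+a j)))
                                                                (*P-congˡ z (≃-sym A′+B′≃A)) ⟩
    u *P (B +P A′) +P v *P A +P z *P (A′ +P B′)      ≈⟨ collect u v z A A′ B B′ ⟩
    (z +P u) *P A′ +P z *P B′ +P (v *P A +P u *P B)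
      ≈⟨ +P-congʳ (v *P A +P u *P B) (+P-congʳ (z *P B′) (*P-congʳ A′ (≃-sym w≃z+u))) ⟩
    numL i j +P numL i (suc j)                       ∎
    where
    A = a (suc j)
    A′ = a j
    B = b (suc j)
    B′ = b j
    u = constP (+ (i C suc j))
    z = constP (+ (i C j))
    v = constP (+ ((i + 1) C (suc j + 1)))
    w = constP (+ ((i + 1) C (j + 1)))
    A′+B′≃A : A′ +P B′ ≃ A
    A′+B′≃A = ≃-trans (a+b≃c j) (c≃a-suc j)
    w≃z+u : w ≃ z +P u
    w≃z+u = ≃-trans (constP-cong w-pascal) (constP-+ (i C j) (i C suc j))
      where
      w-pascal : (i + 1) C (j + 1) ≡ i C j + i C suc j
      w-pascal = trans (cong₂ _C_ (ℕP.+-comm i 1) (ℕP.+-comm j 1)) (pascal i j)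
    p≃v+[z+u] : constP (+ ((i + 2) C (suc j + 1))) ≃ v +P (z +P u)
    p≃v+[z+u] = ≃-trans (constP-cong p-pascal)
                        (≃-trans (constP-+ ((i + 1) C (suc j + 1)) ((i + 1) C (j + 1))) (+P-congˡ v w≃z+u))
      where
      p-pascal : (i + 2) C (suc j + 1) ≡ (i + 1) C (suc j + 1) + (i + 1) C (j + 1)
      p-pascal = trans (cong (_C (suc j + 1)) (ℕP.+-suc i 1))
                       (trans (pascal (i + 1) (j + 1)) (ℕP.+-comm ((i + 1) C (j + 1)) _))
    distribute : ∀ u X v z A → (u *P X +P (v +P (z +P u))) *P A ≃ u *P (A +P X *P A) +P v *P A +P z *P A
    distribute = solve-∀ polyRing
    collect : ∀ u v z A A′ B B′ →
      u *P (B +P A′) +P v *P A +P z *P (A′ +P B′) ≃ (z +P u) *P A′ +P z *P B′ +P (v *P A +P u *P B)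
    collect = solve-∀ polyRing

  LU-term : ℕ → ℕ → ℕ → QX
  LU-term i j m = entryL i m *Q Uent m j

  null-LU-term : ∀ i j m → Uent m j ≡ 0Q → Null (LU-term i j m)
  null-LU-term i j m U≡0 rewrite U≡0 = null-*Q-0Q (entryL i m)

  M≈LU-column : ∀ n i j → j < n → embed (polyM i j) ≈ sumN (LU-term i j) n
  M≈LU-column (suc n) i zero _ =
    ≈-∝-trans (embed (polyM i 0))
      (embed≈q/c*c/a (polyM i 0) (numL i 0) (polyM*a≃numL i) (Uent-diag 0))
      (sumN-single n (LU-term i 0) λ m → null-LU-term i 0 (suc m) (Uent-off (suc m) 0 (λ ()) (λ ())))
  M≈LU-column n i (suc j) 2+j≤n with ℕP.m≤n⇒∃[o]m+o≡n 2+j≤n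
  ... | o , refl =
    ≈-∝-trans (embed (polyM i (suc j)))
      (embed≈q/c′*1+r/c*c/a (polyM i (suc j)) (numL i j) (numL i (suc j))
        (polyM*a≃numL+numL i j) (c≃a-suc j) (Uent-super j) (Uent-diag (suc j)))
      (sumN-window j o (LU-term i (suc j)) before after)
    where
    before : ∀ m → m < j → Null (LU-term i (suc j) m)
    before m m<j = null-LU-term i (suc j) m
      (Uent-off m (suc j) (ℕP.>⇒≢ (ℕP.m<n⇒m<1+n m<j)) (ℕP.>⇒≢ (s≤s m<j)))
    after : ∀ m → Null (LU-term i (suc j) (2 + j + m))
    after m = null-LU-term i (suc j) (2 + j + m)
      (Uent-off (2 + j + m) (suc j) (ℕP.<⇒≢ (s≤s j<1+j+m)) (ℕP.<⇒≢ (s≤s (ℕP.m<n⇒m<1+n j<1+j+m))))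
      where
      j<1+j+m : j < suc (j + m)
      j<1+j+m = s≤s (ℕP.m≤m+n j m)

mainTheorem9 : (n : ℕ) → n ≥ 1 →
    LowerUnitriangular (L n) × (∀ i j → M n i j ≈ (L n ⊗ U n) i j)
mainTheorem9 n _ = (diagonal , upper) , product
  where
  diagonal : ∀ i → L n i i ≈ 1Q
  diagonal i = coeff-≡ (≃-trans (*-identityʳ _) (≃-trans (numL-diag (toℕ i)) (≃-sym (*P-identityˡ _))))
  upper : ∀ i j → toℕ i ℕ.< toℕ j → L n i j ≈ 0Q
  upper i j i<j = coeff-≡ (≃-trans (*-identityʳ _) (numL-upper i<j))
  product : ∀ i j → M n i j ≈ (L n ⊗ U n) i j
  product i j = ≡.subst (M n i j ≈_) (sym (sumQ≡sumN n (LU-term (toℕ i) (toℕ j))))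
                      (M≈LU-column n (toℕ i) (toℕ j) (toℕ<n j))
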